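{- Let $N>1$ be an integer and let $\phi_N:X_0(N^2)\to X_0(N)$ be the $N$-sheeted covering induced by $\Gamma_0(N^2)<\Gamma_0(N)$. Let $[\frac ad]_N$ be a cusp of $X_0(N)$ with $d\mid N$. Then the fibre of $\phi_N$ over $[\frac ad]_N$ consists of $d/\gcd(d,N/d)$ cusps of $X_0(N^2)$, each of the form $[\frac{\tilde a}{\tilde d}]_{N^2}$ with $\tilde d\mid N^2$ and $\gcd(\tilde d,N)=d$, and each of these cusps appears in the fibre with multiplicity (ramification index) $N\gcd(d,N/d)/d$.
   Context: $\Gamma_0(M)$ is the Hecke congruence subgroup of the modular group $\Gamma=SL(2,\mathbb{Z})/\{\pm I\}$ consisting of classes of matrices with lower-left entry divisible by $M$; $X_0(M)=\Gamma_0(M)\backslash(\mathfrak{H}\cup\mathbb{Q}\cup\{i\infty\})$. Cusps of $X_0(M)$ are $\Gamma_0(M)$-equivalence classes in $\mathbb{P}^1(\mathbb{Q})$; $[\frac ad]_M$ denotes the class of $a/d$, and every class has a representative $a/d$ with $d\mid M$, $\gcd(a,d)=1$, the divisor $d$ being an invariant of the class. -}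

module Defs where

open import Data.Nat as ℕ using (ℕ; _<_; _≤_)
open import Data.Nat.Coprimality using (Coprime)
open import Data.Integer as ℤ using (ℤ; +_; ∣_∣; -_)
open import Data.Integer.Divisibility using () renaming (_∣_ to _∣ℤ_)
open import Data.Product using (_×_; _,_; Σ; ∃)
open import Relation.Binary.PropositionalEquality using (_≡_)

record M2 : Set where
  constructor mat
  field
    α β γ δ : ℤ
open M2 public

det : M2 → ℤ
det g = (α g ℤ.* δ g) ℤ.- (β g ℤ.* γ g)

_⊗_ : M2 → M2 → M2
g ⊗ h = mat (α g ℤ.* α h ℤ.+ β g ℤ.* γ h) (α g ℤ.* β h ℤ.+ β g ℤ.* δ h)
            (γ g ℤ.* α h ℤ.+ δ g ℤ.* γ h) (γ g ℤ.* β h ℤ.+ δ g ℤ.* δ h)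

-- inverse of a determinant-one matrix (the adjugate)
inv : M2 → M2
inv g = mat (δ g) (ℤ.- β g) (ℤ.- γ g) (α g)

Tpow : ℕ → M2
Tpow h = mat (+ 1) (+ h) (+ 0) (+ 1)

SL2 : M2 → Set
SL2 g = det g ≡ + 1

InΓ₀ : ℕ → M2 → Set
InΓ₀ M g = SL2 g × (+ M ∣ℤ γ g)

-- A point of ℙ¹(ℚ) is represented by a coprime pair (a , c) standing for a/c
-- (c = 0 is the cusp i∞).  Matrices act linearly on such column vectors.
Pt : Set
Pt = ℤ × ℤ

IsCusp : Pt → Set
IsCusp (a , c) = Coprime ∣ a ∣ ∣ c ∣

act : M2 → Pt → Pt
act g (a , c) = (α g ℤ.* a ℤ.+ β g ℤ.* c , γ g ℤ.* a ℤ.+ δ g ℤ.* c)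

-- Γ₀(M)-equivalence of cusps: x ~ y iff y = ± g x with g ∈ Γ₀(M);
-- since -I ∈ Γ₀(M) the sign can be absorbed into g.
CuspEq : ℕ → Pt → Pt → Set
CuspEq M x y = ∃ λ g → InΓ₀ M g × act g x ≡ y

ParIn : ℕ → Pt → ℕ → Set
ParIn M x h = ∀ g → SL2 g → act g (+ 1 , + 0) ≡ x → InΓ₀ M ((g ⊗ Tpow h) ⊗ inv g)

-- h is the width of the cusp x for Γ₀(M): the least positive h with
-- g T^h g⁻¹ ∈ Γ₀(M) (so the stabiliser of x in Γ₀(M) is generated by ± g T^h g⁻¹)
IsWidth : ℕ → Pt → ℕ → Set
IsWidth M x h = (0 < h) × ParIn M x h × (∀ h' → 0 < h' → ParIn M x h' → h ≤ h')

pt : ℤ × ℕ → Pt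
pt (a , d) = (a , + d)

module Submission where

-- Every element of Γ₀(N) factors as L_j h with h ∈ Γ₀(N²) and L_j = (1 0 ; N j 1), so the Γ₀(N)-class of
-- a/d is the union of the Γ₀(N²)-classes of L_j(a/d) = a/(N j a + d). Write N = d m, g = gcd(d, m), d = k g
-- and m = w g. Conjugating the stabiliser of a/d between two translates shows that the class of L_j(a/d)
-- only depends on j mod k, and the entries of a matrix of Γ₀(N²) carrying L_i(a/d) to L_j(a/d) force
-- k ∣ j - i, so there are exactly k classes. Each L_j(a/d) is Γ₀(N²)-equivalent to a cusp x/t with
-- t = gcd(N j a + d, N²), whence gcd(t, N) = d, t = s d with s prime to m, and the least h with N ∣ h t²
-- (the width over Γ₀(N)) is w, while over Γ₀(N²) it is m², which is e w.

open import Defs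
open import Data.Product using (_×_; _,_; Σ; ∃; proj₁; proj₂)
open import Data.Product.Base using (∃₂; uncurry)
open import Data.Sum.Base using (inj₁; inj₂)
open import Data.List.Base using (_∷_; [])
open import Relation.Binary.PropositionalEquality
  using (_≡_; refl; sym; trans; cong; cong₂; subst; subst₂; module ≡-Reasoning)

module Coprimality where
  open import Data.Nat.Base as ℕ using (ℕ; NonZero; _<_)
  import Data.Nat.Properties as ℕ
  import Data.Nat.Coprimality as ℕ
  import Data.Nat.Divisibility as ℕ
  open import Data.Nat.GCD using (gcd; gcd[m,n]∣m; gcd[m,n]∣n; gcd[m,n]≡0⇒m≡0; module Bézout)
  open import Data.Nat.Induction using (<-rec)
  open import Relation.Nullary.Decidable.Core using (yes; no)
  open import Data.Integer.Base using (ℤ; +_; -[1+_]; ∣_∣; _+_; _*_; -_; _-_; 1ℤ)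
  open import Data.Integer.Properties using (+-comm; *-comm; pos-+; pos-*)
  import Data.Integer.Coprimality as ℤ
  open import Data.Integer.Divisibility.Signed using (_∣_; divides; ∣ᵤ⇒∣; ∣⇒∣ᵤ; ∣m∣n⇒∣m+n; ∣n⇒∣m*n)
  open import Data.Integer.Tactic.RingSolver using (solve)
  open ≡-Reasoning

  private variable
    x y z : ℤ
    m n o : ℕ

  Bézout : ℤ → ℤ → Set
  Bézout x y = ∃₂ λ u v → u * x + v * y ≡ 1ℤ

  bézout-sym : Bézout x y → Bézout y x
  bézout-sym {x} {y} (u , v , e) = v , u , trans (+-comm (v * y) (u * x)) e

  bézout-*ʳ : Bézout x y → Bézout x z → Bézout x (y * z)
  bézout-*ʳ {x} {y} {z} (u₁ , v₁ , e₁) (u₂ , v₂ , e₂) =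
    u₁ * u₂ * x + u₁ * v₂ * z + v₁ * y * u₂ , v₁ * v₂ , (begin
      (u₁ * u₂ * x + u₁ * v₂ * z + v₁ * y * u₂) * x + v₁ * v₂ * (y * z)
        ≡⟨ solve (x ∷ y ∷ z ∷ u₁ ∷ v₁ ∷ u₂ ∷ v₂ ∷ []) ⟩
      (u₁ * x + v₁ * y) * (u₂ * x + v₂ * z)
        ≡⟨ cong₂ _*_ e₁ e₂ ⟩
      1ℤ ∎)

  bézout-*ˡ : Bézout x z → Bézout y z → Bézout (x * y) z
  bézout-*ˡ b₁ b₂ = bézout-sym (bézout-*ʳ (bézout-sym b₁) (bézout-sym b₂))

  bézout-divisorʳ : y ∣ z → Bézout x z → Bézout x y
  bézout-divisorʳ {y} {z} {x} (divides q refl) (u , v , e) =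
    u , v * q , (begin
      u * x + v * q * y     ≡⟨ solve (x ∷ y ∷ q ∷ u ∷ v ∷ []) ⟩
      u * x + v * (q * y)   ≡⟨ e ⟩
      1ℤ                    ∎)

  bézout-shiftʳ : ∀ n → Bézout x y → Bézout x (y + n * x)
  bézout-shiftʳ {x} {y} n (u , v , e) =
    u - v * n , v , (begin
      (u - v * n) * x + v * (y + n * x)   ≡⟨ solve (x ∷ y ∷ n ∷ u ∷ v ∷ []) ⟩
      u * x + v * y                       ≡⟨ e ⟩
      1ℤ                                  ∎)

  bézout-linear : ∀ a b c d → Bézout (a * x + b * y) (c * x + d * y) → Bézout x y
  bézout-linear {x} {y} a b c d (u , v , e) =
    u * a + v * c , u * b + v * d , (begin
      (u * a + v * c) * x + (u * b + v * d) * y   ≡⟨ solve (x ∷ y ∷ a ∷ b ∷ c ∷ d ∷ u ∷ v ∷ []) ⟩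
      u * (a * x + b * y) + v * (c * x + d * y)   ≡⟨ e ⟩
      1ℤ                                          ∎)

  bézout⇒coprime : Bézout x y → ℤ.Coprime x y
  bézout⇒coprime {x} {y} (u , v , e) {i} (i∣x , i∣y) =
    ℕ.∣1⇒≡1 (∣⇒∣ᵤ (subst (+ i ∣_) e (∣m∣n⇒∣m+n (∣n⇒∣m*n u (∣ᵤ⇒∣ i∣x)) (∣n⇒∣m*n v (∣ᵤ⇒∣ i∣y)))))

  private
    bézout-from-ℕ : ∀ {p q} a b → 1ℤ + b * q ≡ a * p → Bézout p q
    bézout-from-ℕ {p} {q} a b e = a , - b , (begin
      a * p + - b * q         ≡⟨ cong (_+ - b * q) (sym e) ⟩
      1ℤ + b * q + - b * q    ≡⟨ solve (b ∷ q ∷ []) ⟩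
      1ℤ                      ∎)

    pos-identity : ∀ a b → 1 ℕ.+ b ℕ.* n ≡ a ℕ.* m → 1ℤ + + b * + n ≡ + a * + m
    pos-identity {n} {m} a b e = begin
      1ℤ + + b * + n      ≡⟨ cong (λ k → 1ℤ + k) (sym (pos-* b n)) ⟩
      1ℤ + + (b ℕ.* n)    ≡⟨ sym (pos-+ 1 (b ℕ.* n)) ⟩
      + (1 ℕ.+ b ℕ.* n)   ≡⟨ cong +_ e ⟩
      + (a ℕ.* m)         ≡⟨ pos-* a m ⟩
      + a * + m           ∎

    bézout-abs : Bézout (+ ∣ x ∣) y → Bézout x y
    bézout-abs {x = + _}      b             = b
    bézout-abs {x = -[1+ n ]} {y} (u , v , e) = - u , v , trans (cong (_+ v * y) (neg-flip u (+ ℕ.suc n))) e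
      where
      neg-flip : ∀ u p → - u * - p ≡ u * p
      neg-flip u p = solve (u ∷ p ∷ [])

  coprime⇒bézout : ℤ.Coprime x y → Bézout x y
  coprime⇒bézout c = bézout-abs (bézout-sym (bézout-abs (bézout-sym (natural (ℕ.coprime-Bézout c)))))
    where
    natural : Bézout.Identity 1 m n → Bézout (+ m) (+ n)
    natural (Bézout.+- a b e) = bézout-from-ℕ (+ a) (+ b) (pos-identity a b e)
    natural (Bézout.-+ a b e) = bézout-sym (bézout-from-ℕ (+ b) (+ a) (pos-identity b a e))

  coprime-*ˡ : ℕ.Coprime m o → ℕ.Coprime n o → ℕ.Coprime (m ℕ.* n) o
  coprime-*ˡ m⊥o n⊥o (i∣mn , i∣o) =
    n⊥o (ℕ.coprime-divisor (λ (j∣i , j∣m) → m⊥o (j∣m , ℕ.∣-trans j∣i i∣o)) i∣mn , i∣o)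

  coprime-∣ˡ : n ℕ.∣ m → ℕ.Coprime m o → ℕ.Coprime n o
  coprime-∣ˡ n∣m m⊥o (i∣n , i∣o) = m⊥o (ℕ.∣-trans i∣n n∣m , i∣o)

  CoprimePart : ℕ → ℕ → Set
  CoprimePart q z = ∃₂ λ s r → z ≡ s ℕ.* r × ℕ.Coprime s q × (∀ {o} → ℕ.Coprime q o → ℕ.Coprime r o)

  coprime-part : ∀ q z → .{{NonZero z}} → CoprimePart q z
  coprime-part q z = <-rec (λ z → 0 < z → CoprimePart q z) split z (ℕ.>-nonZero⁻¹ z)
    where
    split : ∀ z → (∀ {y} → y < z → 0 < y → CoprimePart q y) → 0 < z → CoprimePart q z
    split z rec z>0 with gcd z q ℕ.≟ 1 | gcd[m,n]∣m z q
    ... | yes g≡1 | _ =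
      z , 1 , sym (ℕ.*-identityʳ z) , ℕ.gcd≡1⇒coprime g≡1 , λ _ (i∣1 , _) → ℕ.∣1⇒≡1 i∣1
    ... | no g≢1 | ℕ.divides y z≡yg = extend (rec y<z y>0)
      where
      g = gcd z q
      g>0 : 0 < g
      g>0 = ℕ.n≢0⇒n>0 λ g≡0 → ℕ.<⇒≢ z>0 (sym (gcd[m,n]≡0⇒m≡0 g≡0))
      y>0 : 0 < y
      y>0 = ℕ.n≢0⇒n>0 λ y≡0 → ℕ.<⇒≢ z>0 (sym (trans z≡yg (cong (ℕ._* g) y≡0)))
      y<z : y < z
      y<z = subst (y <_) (sym z≡yg)
              (ℕ.m<m*n y g {{ℕ.>-nonZero y>0}} (ℕ.≤∧≢⇒< g>0 (λ 1≡g → g≢1 (sym 1≡g))))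
      extend : CoprimePart q y → CoprimePart q z
      extend (s , r , y≡sr , s⊥q , r-prop) =
        s , r ℕ.* g , trans z≡yg (trans (cong (ℕ._* g) y≡sr) (ℕ.*-assoc s r g)) , s⊥q ,
        λ q⊥o → coprime-*ˡ (r-prop q⊥o) (coprime-∣ˡ (gcd[m,n]∣n z q) q⊥o)

  -- Take n = s for t = s * w as in CoprimePart ∣ q ∣ t: q + s r is prime to s because q is, and prime
  -- to w because it is prime to q.
  coprime-translate : ∀ {q r} → Bézout q r → ∀ t → .{{NonZero t}} → ∃ λ n → Bézout (q + n * r) (+ t)
  coprime-translate {q} {r} q⊥r t = translate (coprime-part ∣ q ∣ t)
    where
    translate : CoprimePart ∣ q ∣ t → ∃ λ n → Bézout (q + n * r) (+ t)
    translate (s , w , t≡sw , s⊥q , w-prop) =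
      + s , bézout-sym (subst (λ k → Bézout k (q + + s * r)) sw≡t (bézout-*ˡ s⊥q+sr w⊥q+sr))
      where
      s⊥q+sr : Bézout (+ s) (q + + s * r)
      s⊥q+sr = subst (λ k → Bézout (+ s) (q + k)) (*-comm r (+ s)) (bézout-shiftʳ r (coprime⇒bézout {+ s} {q} s⊥q))
      shuffle : ∀ s r q → s * r + 1ℤ * q ≡ q + s * r
      shuffle s r q = solve (s ∷ r ∷ q ∷ [])
      q⊥q+sr : Bézout q (q + + s * r)
      q⊥q+sr = subst (Bézout q) (shuffle (+ s) r q)
                 (bézout-shiftʳ 1ℤ (bézout-*ʳ (bézout-sym (coprime⇒bézout {+ s} {q} s⊥q)) q⊥r))
      w⊥q+sr : Bézout (+ w) (q + + s * r)
      w⊥q+sr = coprime⇒bézout {+ w} (w-prop (bézout⇒coprime q⊥q+sr))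
      sw≡t : + s * + w ≡ + t
      sw≡t = trans (sym (pos-* s w)) (cong +_ (sym t≡sw))

  bézout-coefficient-coprime : ∀ {u v} → u * x + v * y ≡ 1ℤ → ∀ t → .{{NonZero t}} →
    ∃₂ λ u′ v′ → u′ * x + v′ * y ≡ 1ℤ × Bézout v′ (+ t)
  bézout-coefficient-coprime {x} {y} {u} {v} e t = shift (coprime-translate v⊥x t)
    where
    v⊥x : Bézout v x
    v⊥x = y , u , (begin
      y * v + u * x   ≡⟨ solve (x ∷ y ∷ u ∷ v ∷ []) ⟩
      u * x + v * y   ≡⟨ e ⟩
      1ℤ              ∎)
    shift : ∃ (λ n → Bézout (v + n * x) (+ t)) → ∃₂ λ u′ v′ → u′ * x + v′ * y ≡ 1ℤ × Bézout v′ (+ t)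
    shift (n , b) = u - n * y , v + n * x , (begin
      (u - n * y) * x + (v + n * x) * y   ≡⟨ solve (x ∷ y ∷ u ∷ v ∷ n ∷ []) ⟩
      u * x + v * y                       ≡⟨ e ⟩
      1ℤ                                  ∎) , b

module ModularGroup where
  open import Data.Nat.Base as ℕ using (ℕ)
  import Data.Nat.Divisibility as ℕ
  open import Data.Integer.Base using (ℤ; +_; _+_; _*_; -_; _-_; 0ℤ; 1ℤ)
  open import Data.Integer.Properties using (*-identityˡ; pos-*; ∣-i∣≡∣i∣)
  open import Data.Integer.Divisibility.Signed using (_∣_; divides; ∣ᵤ⇒∣; ∣⇒∣ᵤ; ∣m∣n⇒∣m+n; ∣m⇒∣m*n; ∣n⇒∣m*n)
  open import Data.Integer.Tactic.RingSolver using (solve)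
  open Coprimality
  open ≡-Reasoning

  private variable
    g h : M2
    M M′ : ℕ
    p q r : Pt
    c : ℤ

  act-⊗ : ∀ g h p → act (g ⊗ h) p ≡ act g (act h p)
  act-⊗ (mat a b c d) (mat a′ b′ c′ d′) (x , y) = cong₂ _,_ (row a b) (row c d)
    where
    row : ∀ a b → (a * a′ + b * c′) * x + (a * b′ + b * d′) * y ≡ a * (a′ * x + b′ * y) + b * (c′ * x + d′ * y)
    row a b = solve (a ∷ b ∷ a′ ∷ b′ ∷ c′ ∷ d′ ∷ x ∷ y ∷ [])

  det-⊗ : ∀ g h → det (g ⊗ h) ≡ det g * det h
  det-⊗ (mat a b c d) (mat a′ b′ c′ d′) = expanded
    where
    expanded : (a * a′ + b * c′) * (c * b′ + d * d′) - (a * b′ + b * d′) * (c * a′ + d * c′)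
               ≡ (a * d - b * c) * (a′ * d′ - b′ * c′)
    expanded = solve (a ∷ b ∷ c ∷ d ∷ a′ ∷ b′ ∷ c′ ∷ d′ ∷ [])

  det-inv : ∀ g → det (inv g) ≡ det g
  det-inv (mat a b c d) = expanded
    where
    expanded : d * a - (- b) * (- c) ≡ a * d - b * c
    expanded = solve (a ∷ b ∷ c ∷ d ∷ [])

  SL2-⊗ : SL2 g → SL2 h → SL2 (g ⊗ h)
  SL2-⊗ {g} {h} e₁ e₂ = trans (det-⊗ g h) (cong₂ _*_ e₁ e₂)

  act-inv : SL2 g → ∀ p → act (inv g) (act g p) ≡ p
  act-inv {mat a b c d} e (x , y) = cong₂ _,_ (unit x first) (unit y second)
    where
    unit : ∀ z {w} → w ≡ (a * d - b * c) * z → w ≡ z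
    unit z w≡ = trans w≡ (trans (cong (_* z) e) (*-identityˡ z))
    first : d * (a * x + b * y) + - b * (c * x + d * y) ≡ (a * d - b * c) * x
    first = solve (a ∷ b ∷ c ∷ d ∷ x ∷ y ∷ [])
    second : - c * (a * x + b * y) + a * (c * x + d * y) ≡ (a * d - b * c) * y
    second = solve (a ∷ b ∷ c ∷ d ∷ x ∷ y ∷ [])

  inΓ₀ : SL2 g → + M ∣ γ g → InΓ₀ M g
  inΓ₀ e M∣γ = e , ∣⇒∣ᵤ M∣γ

  InΓ₀-⊗ : InΓ₀ M g → InΓ₀ M h → InΓ₀ M (g ⊗ h)
  InΓ₀-⊗ {g = g} {h} (e₁ , M∣γg) (e₂ , M∣γh) =
    inΓ₀ {g ⊗ h} (SL2-⊗ {g} {h} e₁ e₂) (∣m∣n⇒∣m+n (∣m⇒∣m*n (α h) (∣ᵤ⇒∣ {i = γ g} M∣γg)) (∣n⇒∣m*n (δ g) (∣ᵤ⇒∣ {i = γ h} M∣γh)))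

  InΓ₀-inv : InΓ₀ M g → InΓ₀ M (inv g)
  InΓ₀-inv {M} {g} (e , M∣γ) = trans (det-inv g) e , subst (M ℕ.∣_) (sym (∣-i∣≡∣i∣ (γ g))) M∣γ

  InΓ₀-∣ : M ℕ.∣ M′ → InΓ₀ M′ g → InΓ₀ M g
  InΓ₀-∣ M∣M′ (e , M′∣γ) = e , ℕ.∣-trans M∣M′ M′∣γ

  cuspEq-sym : CuspEq M p q → CuspEq M q p
  cuspEq-sym {p = p} (g , Γg , gp≡q) = inv g , InΓ₀-inv {g = g} Γg , trans (cong (act (inv g)) (sym gp≡q)) (act-inv {g} (proj₁ Γg) p)

  cuspEq-trans : CuspEq M p q → CuspEq M q r → CuspEq M p r
  cuspEq-trans {p = p} (g , Γg , gp≡q) (h , Γh , hq≡r) =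
    h ⊗ g , InΓ₀-⊗ {g = h} {g} Γh Γg , trans (act-⊗ h g p) (trans (cong (act h) gp≡q) hq≡r)

  cuspEq-∣ : M ℕ.∣ M′ → CuspEq M′ p q → CuspEq M p q
  cuspEq-∣ M∣M′ (g , Γg , gp≡q) = g , InΓ₀-∣ {g = g} M∣M′ Γg , gp≡q

  bézout-act : SL2 g → uncurry Bézout p → uncurry Bézout (act g p)
  bézout-act {g} {p} e b = bézout-linear (δ g) (- β g) (- γ g) (α g) (subst (uncurry Bézout) (sym (act-inv {g} e p)) b)

  lower : ℤ → M2
  lower c = mat 1ℤ 0ℤ c 1ℤ

  SL2-lower : ∀ c → SL2 (lower c)
  SL2-lower c = expanded
    where
    expanded : 1ℤ * 1ℤ - 0ℤ * c ≡ 1ℤ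
    expanded = solve (c ∷ [])

  InΓ₀-lower : + M ∣ c → InΓ₀ M (lower c)
  InΓ₀-lower {c = c} M∣c = inΓ₀ {lower c} (SL2-lower c) M∣c

  act-lower : ∀ c x y → act (lower c) (x , y) ≡ (x , c * x + y)
  act-lower c x y = cong₂ _,_ first second
    where
    first : 1ℤ * x + 0ℤ * y ≡ x
    first = solve (x ∷ y ∷ [])
    second : c * x + 1ℤ * y ≡ c * x + y
    second = solve (c ∷ x ∷ y ∷ [])

  act-lower-cancel : ∀ c x y → act (lower (- c)) (x , c * x + y) ≡ (x , y)
  act-lower-cancel c x y = trans (act-lower (- c) x (c * x + y)) (cong (x ,_) (cancel c x y))
    where
    cancel : ∀ c x y → - c * x + (c * x + y) ≡ y
    cancel c x y = solve (c ∷ x ∷ y ∷ [])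

  -- For g = (a b ; q M d) the lower-left entry of L_j g is M (q + j a); with j = - q d it is
  -- M q (1 - a d) = - M² q² b.
  Γ₀-lift : InΓ₀ M g → ∃ λ j → InΓ₀ (M ℕ.* M) (lower (+ M * j) ⊗ g)
  Γ₀-lift {M} {mat a b c d} (e , M∣c) = lift (∣ᵤ⇒∣ {i = c} M∣c) e
    where
    lift : + M ∣ c → SL2 (mat a b c d) → ∃ λ j → InΓ₀ (M ℕ.* M) (lower (+ M * j) ⊗ mat a b c d)
    lift (divides q refl) e = j , inΓ₀ {lower (+ M * j) ⊗ g′} (SL2-⊗ {lower (+ M * j)} {g′} (SL2-lower (+ M * j)) e)
      (subst (_∣ γ (lower (+ M * j) ⊗ g′)) (sym (pos-* M M)) (divides (- (q * q * b)) (lower-left (+ M) e)))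
      where
      j = - (q * d)
      g′ = mat a b (q * + M) d
      lower-left : ∀ M → a * d - b * (q * M) ≡ 1ℤ → M * - (q * d) * a + 1ℤ * (q * M) ≡ - (q * q * b) * (M * M)
      lower-left M e = begin
        M * - (q * d) * a + 1ℤ * (q * M)
          ≡⟨ solve (M ∷ q ∷ a ∷ b ∷ d ∷ []) ⟩
        - (q * q * b) * (M * M) + M * q * (1ℤ - (a * d - b * (q * M)))
          ≡⟨ cong (λ k → - (q * q * b) * (M * M) + M * q * (1ℤ - k)) e ⟩
        - (q * q * b) * (M * M) + M * q * (1ℤ - 1ℤ)
          ≡⟨ solve (M ∷ q ∷ b ∷ []) ⟩
        - (q * q * b) * (M * M) ∎

  cuspEq-lift : CuspEq M p q → ∃ λ j → CuspEq (M ℕ.* M) p (act (lower (+ M * j)) q)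
  cuspEq-lift {M} {p} {q} (g , Γg , gp≡q) = lifted (Γ₀-lift {g = g} Γg)
    where
    lifted : ∃ (λ j → InΓ₀ (M ℕ.* M) (lower (+ M * j) ⊗ g)) → ∃ λ j → CuspEq (M ℕ.* M) p (act (lower (+ M * j)) q)
    lifted (j , Γh) = j , lower (+ M * j) ⊗ g , Γh , trans (act-⊗ (lower (+ M * j)) g p) (cong (act (lower (+ M * j))) gp≡q)

module CuspWidths where
  open import Data.Nat.Base as ℕ using (ℕ; _<_)
  import Data.Nat.Divisibility as ℕ
  open import Data.Integer.Base using (ℤ; +_; ∣_∣; _+_; _*_; -_; _-_; 0ℤ; 1ℤ)
  open import Data.Integer.Properties using (abs-*; ∣-i∣≡∣i∣)
  open import Data.Integer.Tactic.RingSolver using (solve)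
  open Coprimality
  open ModularGroup
  open ≡-Reasoning

  private variable
    g : M2
    M t w : ℕ
    x : ℤ

  act-∞ : ∀ g → act g (1ℤ , 0ℤ) ≡ (α g , γ g)
  act-∞ (mat a b c d) = cong₂ _,_ (unit a b) (unit c d)
    where
    unit : ∀ a b → a * 1ℤ + b * 0ℤ ≡ a
    unit a b = solve (a ∷ b ∷ [])

  SL2-Tpow : ∀ h → SL2 (Tpow h)
  SL2-Tpow h = expanded (+ h)
    where
    expanded : ∀ h → 1ℤ * 1ℤ - h * 0ℤ ≡ 1ℤ
    expanded h = solve (h ∷ [])

  SL2-conjugate : ∀ h → SL2 g → SL2 ((g ⊗ Tpow h) ⊗ inv g)
  SL2-conjugate {g} h e = SL2-⊗ {g ⊗ Tpow h} {inv g} (SL2-⊗ {g} {Tpow h} e (SL2-Tpow h)) (trans (det-inv g) e)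

  -- g T^h g⁻¹ = 1 + h (g e₁)(g e₁)^⊥, so its lower-left entry is -h c² for c the lower-left entry of g.
  ∣γ-conjugate∣ : ∀ g h → ∣ γ ((g ⊗ Tpow h) ⊗ inv g) ∣ ≡ h ℕ.* (∣ γ g ∣ ℕ.* ∣ γ g ∣)
  ∣γ-conjugate∣ (mat a b c d) h = begin
    ∣ (c * 1ℤ + d * 0ℤ) * d + (c * + h + d * 1ℤ) * - c ∣   ≡⟨ cong ∣_∣ (expanded (+ h)) ⟩
    ∣ - (+ h * (c * c)) ∣                                 ≡⟨ ∣-i∣≡∣i∣ (+ h * (c * c)) ⟩
    ∣ + h * (c * c) ∣                                     ≡⟨ abs-* (+ h) (c * c) ⟩
    h ℕ.* ∣ c * c ∣                                       ≡⟨ cong (h ℕ.*_) (abs-* c c) ⟩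
    h ℕ.* (∣ c ∣ ℕ.* ∣ c ∣)                               ∎
    where
    expanded : ∀ h → (c * 1ℤ + d * 0ℤ) * d + (c * h + d * 1ℤ) * - c ≡ - (h * (c * c))
    expanded h = solve (c ∷ d ∷ h ∷ [])

  ∣⇒parIn : M ℕ.∣ w ℕ.* (t ℕ.* t) → ParIn M (x , + t) w
  ∣⇒parIn {M} {w} {t} M∣ g e g∞≡x = SL2-conjugate {g} w e , subst (M ℕ.∣_) (sym ∣γ∣≡) M∣
    where
    ∣γ∣≡ : ∣ γ ((g ⊗ Tpow w) ⊗ inv g) ∣ ≡ w ℕ.* (t ℕ.* t)
    ∣γ∣≡ = trans (∣γ-conjugate∣ g w) (cong (λ c → w ℕ.* (∣ c ∣ ℕ.* ∣ c ∣)) (cong proj₂ (trans (sym (act-∞ g)) g∞≡x)))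

  parIn⇒∣ : Bézout x (+ t) → ParIn M (x , + t) w → M ℕ.∣ w ℕ.* (t ℕ.* t)
  parIn⇒∣ {x} {t} {M} {w} (u , v , e) par = subst (M ℕ.∣_) (∣γ-conjugate∣ g₀ w) (proj₂ (par g₀ det≡1 (act-∞ g₀)))
    where
    g₀ = mat x (- v) (+ t) u
    expanded : ∀ x u v t → x * u - (- v) * t ≡ u * x + v * t
    expanded x u v t = solve (x ∷ u ∷ v ∷ t ∷ [])
    det≡1 : x * u - (- v) * + t ≡ 1ℤ
    det≡1 = trans (expanded x u v (+ t)) e

  isWidth : Bézout x (+ t) → 0 < w → M ℕ.∣ w ℕ.* (t ℕ.* t) → (∀ w′ → M ℕ.∣ w′ ℕ.* (t ℕ.* t) → w ℕ.∣ w′) →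
    IsWidth M (x , + t) w
  isWidth b w>0 M∣ least =
    w>0 , ∣⇒parIn M∣ , λ w′ w′>0 par → ℕ.∣⇒≤ {{ℕ.>-nonZero w′>0}} (least w′ (parIn⇒∣ b par))

module CuspNormalForm where
  open import Data.Nat.Base as ℕ using (ℕ; NonZero)
  import Data.Nat.Coprimality as ℕ
  import Data.Nat.Divisibility as ℕ
  open import Data.Nat.DivMod using (m*n/n≡m)
  open import Data.Nat.GCD using (gcd; gcd[m,n]∣m; gcd[m,n]∣n; gcd[m,n]≢0)
  open import Data.Integer.Base using (ℤ; +_; ∣_∣; _+_; _*_; -_; _-_; 1ℤ)
  open import Data.Integer.Properties using (*-comm; *-identityˡ; pos-*; abs-*)
  open import Data.Integer.Divisibility.Signed using (_∣_; divides; ∣ᵤ⇒∣)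
  open import Data.Integer.Tactic.RingSolver using (solve)
  open Coprimality
  open ModularGroup
  open ≡-Reasoning

  private variable
    M : ℕ
    x c : ℤ

  Γ₀-bottom-row : ∀ {c d} → Bézout d c → + M ∣ c → ∃₂ λ a b → InΓ₀ M (mat a b c d)
  Γ₀-bottom-row {c = c} {d} (u , v , e) M∣c = u , - v , inΓ₀ {mat u (- v) c d} (trans (expanded u v c d) e) M∣c
    where
    expanded : ∀ u v c d → u * d - (- v) * c ≡ u * d + v * c
    expanded u v c d = solve (u ∷ v ∷ c ∷ d ∷ [])

  -- A row (u M, v) of Γ₀(M) with u M₀ x + v c₀ = 1 sends (x , c₀ t) to (_ , t); v is chosen prime to t
  -- so that the row can be completed to a matrix of determinant 1.
  cuspEq-denominator : ∀ {M₀ c c₀} t .{{_ : NonZero t}} → M ≡ M₀ ℕ.* t → c ≡ c₀ * + t →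
    Bézout c₀ (+ M₀) → Bézout x c → ∃ λ x′ → Bézout x′ (+ t) × CuspEq M (x , c) (x′ , + t)
  cuspEq-denominator {x = x} {M₀} {c₀ = c₀} t refl refl c₀⊥M₀ x⊥c = complete (row (bézout-sym (bézout-*ʳ c₀⊥M₀ c₀⊥x)))
    where
    c₀⊥x : Bézout c₀ x
    c₀⊥x = bézout-sym (bézout-divisorʳ (divides (+ t) (*-comm c₀ (+ t))) x⊥c)
    row : Bézout (+ M₀ * x) c₀ → ∃₂ λ u v → u * (+ M₀ * x) + v * c₀ ≡ 1ℤ × Bézout v (+ t)
    row (u , v , e) = bézout-coefficient-coprime {u = u} {v} e t
    factor : ∀ u m t x v c → u * (m * t) * x + v * (c * t) ≡ (u * (m * x) + v * c) * t
    factor u m t x v c = solve (u ∷ m ∷ t ∷ x ∷ v ∷ c ∷ [])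
    swap₁ : ∀ u v c m x → c * v + m * x * u ≡ u * (m * x) + v * c
    swap₁ u v c m x = solve (u ∷ v ∷ c ∷ m ∷ x ∷ [])
    swap₂ : ∀ u v c m x → c * v + u * x * m ≡ u * (m * x) + v * c
    swap₂ u v c m x = solve (u ∷ v ∷ c ∷ m ∷ x ∷ [])
    complete : (∃₂ λ u v → u * (+ M₀ * x) + v * c₀ ≡ 1ℤ × Bézout v (+ t)) →
      ∃ λ x′ → Bézout x′ (+ t) × CuspEq (M₀ ℕ.* t) (x , c₀ * + t) (x′ , + t)
    complete (u , v , e , v⊥t) = finish (Γ₀-bottom-row v⊥C (divides u refl))
      where
      C = u * + (M₀ ℕ.* t)
      v⊥u : Bézout v u
      v⊥u = c₀ , + M₀ * x , trans (swap₁ u v c₀ (+ M₀) x) e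
      v⊥M₀ : Bézout v (+ M₀)
      v⊥M₀ = c₀ , u * x , trans (swap₂ u v c₀ (+ M₀) x) e
      v⊥C : Bézout v C
      v⊥C = subst (λ k → Bézout v (u * k)) (sym (pos-* M₀ t)) (bézout-*ʳ v⊥u (bézout-*ʳ v⊥M₀ v⊥t))
      bottom : C * x + v * (c₀ * + t) ≡ + t
      bottom = begin
        C * x + v * (c₀ * + t)                     ≡⟨ cong (λ k → u * k * x + v * (c₀ * + t)) (pos-* M₀ t) ⟩
        u * (+ M₀ * + t) * x + v * (c₀ * + t)      ≡⟨ factor u (+ M₀) (+ t) x v c₀ ⟩
        (u * (+ M₀ * x) + v * c₀) * + t            ≡⟨ cong (_* + t) e ⟩
        1ℤ * + t                                   ≡⟨ *-identityˡ (+ t) ⟩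
        + t                                        ∎
      finish : (∃₂ λ a b → InΓ₀ (M₀ ℕ.* t) (mat a b C v)) →
        ∃ λ x′ → Bézout x′ (+ t) × CuspEq (M₀ ℕ.* t) (x , c₀ * + t) (x′ , + t)
      finish (a , b , Γ) = a * x + b * (c₀ * + t) ,
        subst (Bézout _) bottom (bézout-act {mat a b C v} (proj₁ Γ) x⊥c) ,
        mat a b C v , Γ , cong (a * x + b * (c₀ * + t) ,_) bottom

  cuspEq-gcd-denominator : ∀ M .{{_ : NonZero M}} → Bézout x c →
    ∃ λ x′ → Bézout x′ (+ gcd ∣ c ∣ M) × CuspEq M (x , c) (x′ , + gcd ∣ c ∣ M)
  cuspEq-gcd-denominator {x} {c} M x⊥c = split (∣ᵤ⇒∣ {+ d} {c} (gcd[m,n]∣m ∣ c ∣ M)) (gcd[m,n]∣n ∣ c ∣ M)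
    where
    d = gcd ∣ c ∣ M
    instance
      d≢0 : NonZero d
      d≢0 = ℕ.≢-nonZero (gcd[m,n]≢0 ∣ c ∣ M (inj₂ (ℕ.≢-nonZero⁻¹ M)))
    split : + d ∣ c → d ℕ.∣ M → ∃ λ x′ → Bézout x′ (+ d) × CuspEq M (x , c) (x′ , + d)
    split (divides c₀ c≡c₀d) (ℕ.divides M₀ M≡M₀d) =
      cuspEq-denominator d M≡M₀d c≡c₀d (coprime⇒bézout {c₀} {+ M₀} c₀⊥M₀) x⊥c
      where
      c₀⊥M₀ : ℕ.Coprime ∣ c₀ ∣ M₀
      c₀⊥M₀ = subst₂ ℕ.Coprime
        (trans (cong (ℕ._/ d) (trans (cong ∣_∣ c≡c₀d) (abs-* c₀ (+ d)))) (m*n/n≡m ∣ c₀ ∣ d))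
        (trans (cong (ℕ._/ d) M≡M₀d) (m*n/n≡m M₀ d))
        (ℕ.coprime-/gcd ∣ c ∣ M)

module LowerTranslates where
  open import Data.Integer.Base using (ℤ; +_; _+_; _*_; -_; _-_; 1ℤ; NonZero)
  open import Data.Integer.Properties using (*-comm; *-cancelˡ-≡)
  import Data.Integer.Coprimality as ℤ
  import Data.Integer.Divisibility as ℤ
  open import Data.Integer.Divisibility.Signed using (_∣_; divides; ∣ᵤ⇒∣; ∣⇒∣ᵤ)
  open import Data.Integer.Tactic.RingSolver using (solve)
  open Coprimality
  open ModularGroup
  open ≡-Reasoning

  -- 1 + n v v^⊥ for v = (a , d) and v^⊥ = (- d , a).
  stab : ℤ → ℤ → ℤ → M2
  stab n a d = mat (1ℤ - n * a * d) (n * a * a) (- (n * d * d)) (1ℤ + n * a * d)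

  SL2-stab : ∀ n a d → SL2 (stab n a d)
  SL2-stab n a d = expanded
    where
    expanded : (1ℤ - n * a * d) * (1ℤ + n * a * d) - n * a * a * - (n * d * d) ≡ 1ℤ
    expanded = solve (n ∷ a ∷ d ∷ [])

  act-stab : ∀ n a d → act (stab n a d) (a , d) ≡ (a , d)
  act-stab n a d = cong₂ _,_ first second
    where
    first : (1ℤ - n * a * d) * a + n * a * a * d ≡ a
    first = solve (n ∷ a ∷ d ∷ [])
    second : - (n * d * d) * a + (1ℤ + n * a * d) * d ≡ d
    second = solve (n ∷ a ∷ d ∷ [])

  -- With P = 1 + m J a and Q = 1 + m j a, the lower-left entry is -d²(W r + n P Q); since P Q = 1 + m Y,
  -- the factor 1 - m Y inverts P Q modulo m², which makes this entry divisible by N².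
  shift-lower-left : ∀ a K G W j r →
    let d = K * G
        m = W * G
        N = d * m
        J = j + K * r
        Y = a * (J + j) + G * J * j * W * a * a
        n = W * - (r * (1ℤ - m * Y))
    in (N * j * (1ℤ - n * a * d) + 1ℤ * - (n * d * d)) * 1ℤ + (N * j * (n * a * a) + 1ℤ * (1ℤ + n * a * d)) * - (N * J)
       ≡ - (r * W * Y * Y) * (N * N)
  shift-lower-left a K G W j r = solve (a ∷ K ∷ G ∷ W ∷ j ∷ r ∷ [])

  cuspEq-shift : ∀ M {N d m K G W} → + M ≡ N * N → N ≡ d * m → d ≡ K * G → m ≡ W * G → ∀ a j r →
    CuspEq M (a , N * (j + K * r) * a + d) (a , N * j * a + d)
  cuspEq-shift M {K = K} {G} {W} M≡NN refl refl refl a j r = h , inΓ₀ {h} SL2-h M∣γ , moves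
    where
    d = K * G
    m = W * G
    N = d * m
    J = j + K * r
    Y = a * (J + j) + G * J * j * W * a * a
    n = W * - (r * (1ℤ - m * Y))
    L = lower (N * j)
    S = stab n a d
    L⁻ = lower (- (N * J))
    h = (L ⊗ S) ⊗ L⁻
    SL2-h : SL2 h
    SL2-h = SL2-⊗ {L ⊗ S} {L⁻} (SL2-⊗ {L} {S} (SL2-lower (N * j)) (SL2-stab n a d)) (SL2-lower (- (N * J)))
    M∣γ : + M ∣ γ h
    M∣γ = subst (_∣ γ h) (sym M≡NN) (divides (- (r * W * Y * Y)) (shift-lower-left a K G W j r))
    moves : act h (a , N * J * a + d) ≡ (a , N * j * a + d)
    moves = begin
      act h (a , N * J * a + d)                   ≡⟨ act-⊗ (L ⊗ S) L⁻ (a , N * J * a + d) ⟩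
      act (L ⊗ S) (act L⁻ (a , N * J * a + d))    ≡⟨ cong (act (L ⊗ S)) (act-lower-cancel (N * J) a d) ⟩
      act (L ⊗ S) (a , d)                         ≡⟨ act-⊗ L S (a , d) ⟩
      act L (act S (a , d))                       ≡⟨ cong (act L) (act-stab n a d) ⟩
      act L (a , d)                               ≡⟨ act-lower (N * j) a d ⟩
      (a , N * j * a + d)                         ∎

  -- The lower row of a matrix (α β ; c N² δ) carrying (a , N i a + d) to (a , N j a + d), and the upper
  -- row of its inverse; α has been eliminated.
  separation-identity : ∀ a d m i j c δ β →
    let N = d * m
        P = 1ℤ + m * i * a
        Q = 1ℤ + m * j * a
    in c * (N * N) * a + δ * (N * i * a + d) ≡ N * j * a + d →
       δ * a + - β * (N * j * a + d) ≡ a →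
       d * (m * (a * a) * (j - i)) ≡ d * (d * (c * m * m * a * a + β * P * Q))
  separation-identity a d m i j c δ β lower-row upper-row =
    let N = d * m
        P = 1ℤ + m * i * a
        Q = 1ℤ + m * j * a
    in begin
    d * (m * (a * a) * (j - i))
      ≡⟨ solve (a ∷ d ∷ m ∷ i ∷ j ∷ []) ⟩
    a * (N * j * a + d) - (N * i * a + d) * a
      ≡⟨ cong₂ (λ u v → a * u - (N * i * a + d) * v) (sym lower-row) (sym upper-row) ⟩
    a * (c * (N * N) * a + δ * (N * i * a + d)) - (N * i * a + d) * (δ * a + - β * (N * j * a + d))
      ≡⟨ solve (a ∷ d ∷ m ∷ i ∷ j ∷ c ∷ δ ∷ β ∷ []) ⟩
    d * (d * (c * m * m * a * a + β * P * Q)) ∎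

  cuspEq⇒∣ : ∀ M {N d m a} → + M ≡ N * N → N ≡ d * m → .{{NonZero d}} → Bézout a d → ∀ i j →
    CuspEq M (a , N * i * a + d) (a , N * j * a + d) → d ℤ.∣ m * (j - i)
  cuspEq⇒∣ M {d = d} {m} {a} M≡NN refl a⊥d i j (mat α β c δ , (e , M∣c) , hp≡q) = separate (∣ᵤ⇒∣ {+ M} {c} M∣c)
    where
    h = mat α β c δ
    N = d * m
    d⊥a² : ℤ.Coprime d (a * a)
    d⊥a² = bézout⇒coprime (bézout-*ʳ (bézout-sym a⊥d) (bézout-sym a⊥d))
    upper-row : δ * a + - β * (N * j * a + d) ≡ a
    upper-row = cong proj₁ (trans (cong (act (inv h)) (sym hp≡q)) (act-inv {h} e (a , N * i * a + d)))
    separate : + M ∣ c → d ℤ.∣ m * (j - i)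
    separate (divides c′ c≡c′M) = ℤ.coprime-divisor d (a * a) (m * (j - i)) d⊥a² (∣⇒∣ᵤ (divides X quotient))
      where
      X = c′ * m * m * a * a + β * (1ℤ + m * i * a) * (1ℤ + m * j * a)
      lower-row : c′ * (N * N) * a + δ * (N * i * a + d) ≡ N * j * a + d
      lower-row = trans (cong (λ c → c * a + δ * (N * i * a + d)) (sym (trans c≡c′M (cong (c′ *_) M≡NN))))
                        (cong proj₂ hp≡q)
      reorder : ∀ a m k → a * a * (m * k) ≡ m * (a * a) * k
      reorder a m k = solve (a ∷ m ∷ k ∷ [])
      quotient : a * a * (m * (j - i)) ≡ X * d
      quotient = begin
        a * a * (m * (j - i))     ≡⟨ reorder a m (j - i) ⟩
        m * (a * a) * (j - i)     ≡⟨ *-cancelˡ-≡ d _ _ (separation-identity a d m i j c′ δ β lower-row upper-row) ⟩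
        d * X                     ≡⟨ *-comm d X ⟩
        X * d                     ∎

module FibreArithmetic where
  open import Data.Nat.Base using (ℕ; NonZero; _*_; _<_; _≤_; _⊔_; zero; suc)
  import Data.Nat.Properties as ℕ
  open import Data.Nat.Coprimality using (Coprime; coprime-divisor; coprime⇒gcd≡1; gcd≡1⇒coprime)
  import Data.Nat.Coprimality as Coprime
  open import Data.Nat.Divisibility using (_∣_; divides; ∣-refl; ∣-antisym; m∣m*n; *-cancelˡ-∣; *-cancelʳ-∣; >⇒∤)
  open import Data.Nat.GCD using (gcd; gcd[m,n]∣m; gcd[m,n]∣n; gcd-assoc; gcd-greatest; c*gcd[m,n]≡gcd[cm,cn])
  open import Data.Nat.Tactic.RingSolver using (solve-∀)
  open import Data.Integer.Base as ℤ using (ℤ; +_; ∣_∣; 1ℤ)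
  import Data.Integer.Properties as ℤ
  import Data.Integer.Tactic.RingSolver as ℤ-Solver
  open import Data.Empty using (⊥-elim)
  open Coprimality using (bézout⇒coprime; coprime-*ˡ; coprime-∣ˡ)
  open ≡-Reasoning

  private variable
    N d m k g w s t e i j : ℕ

  ∣-cancel-common : d ≡ k * g → m ≡ w * g → .{{NonZero g}} → Coprime k w → ∀ x → d ∣ m * x → k ∣ x
  ∣-cancel-common {k = k} {g} {w = w} refl refl k⊥w x kg∣wgx =
    coprime-divisor k⊥w (*-cancelʳ-∣ g (subst (k * g ∣_) (shuffle w g x) kg∣wgx))
    where
    shuffle : ∀ w g x → w * g * x ≡ w * x * g
    shuffle = solve-∀

  ≡-if-∣-difference : i < k → j < k → k ∣ ∣ + j ℤ.- + i ∣ → i ≡ j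
  ≡-if-∣-difference {i} {k} {j} i<k j<k k∣ =
    sym (ℤ.+-injective (ℤ.i-j≡0⇒i≡j (+ j) (+ i) (ℤ.∣i∣≡0⇒i≡0 (zero-if-small k∣ bound))))
    where
    bound : ∣ + j ℤ.- + i ∣ < k
    bound = ℕ.≤-<-trans (subst (_≤ j ⊔ i) (cong ∣_∣ (sym (ℤ.m-n≡m⊖n j i))) (ℤ.∣m⊝n∣≤m⊔n j i)) (ℕ.⊔-lub j<k i<k)
    zero-if-small : ∀ {n} → k ∣ n → n < k → n ≡ 0
    zero-if-small {zero}  _  _   = refl
    zero-if-small {suc _} k∣n n<k = ⊥-elim (>⇒∤ n<k k∣n)

  gcd-lower-translate : ∀ a j → N ≡ d * m → gcd (gcd ∣ + N ℤ.* j ℤ.* a ℤ.+ + d ∣ (N * N)) N ≡ d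
  gcd-lower-translate {d = d} {m} a j refl = begin
    gcd (gcd X (d * m * (d * m))) (d * m)    ≡⟨ gcd-assoc X (d * m * (d * m)) (d * m) ⟩
    gcd X (gcd (d * m * (d * m)) (d * m))    ≡⟨ cong (gcd X) (gcd[nn,n]≡n (d * m)) ⟩
    gcd X (d * m)                            ≡⟨ cong (λ x → gcd x (d * m)) X≡dC ⟩
    gcd (d * ∣ C ∣) (d * m)                  ≡⟨ sym (c*gcd[m,n]≡gcd[cm,cn] d ∣ C ∣ m) ⟩
    d * gcd ∣ C ∣ m                          ≡⟨ cong (d *_) (coprime⇒gcd≡1 C⊥m) ⟩
    d * 1                                    ≡⟨ ℕ.*-identityʳ d ⟩
    d                                        ∎
    where
    X = ∣ + (d * m) ℤ.* j ℤ.* a ℤ.+ + d ∣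
    C = 1ℤ ℤ.+ + m ℤ.* j ℤ.* a
    gcd[nn,n]≡n : ∀ n → gcd (n * n) n ≡ n
    gcd[nn,n]≡n n = ∣-antisym (gcd[m,n]∣n (n * n) n) (gcd-greatest (m∣m*n n) ∣-refl)
    factor : ∀ d m j a → d ℤ.* m ℤ.* j ℤ.* a ℤ.+ d ≡ d ℤ.* (1ℤ ℤ.+ m ℤ.* j ℤ.* a)
    factor = ℤ-Solver.solve-∀
    X≡dC : X ≡ d * ∣ C ∣
    X≡dC = begin
      ∣ + (d * m) ℤ.* j ℤ.* a ℤ.+ + d ∣       ≡⟨ cong (λ n → ∣ n ℤ.* j ℤ.* a ℤ.+ + d ∣) (ℤ.pos-* d m) ⟩
      ∣ + d ℤ.* + m ℤ.* j ℤ.* a ℤ.+ + d ∣     ≡⟨ cong ∣_∣ (factor (+ d) (+ m) j a) ⟩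
      ∣ + d ℤ.* C ∣                           ≡⟨ ℤ.abs-* (+ d) C ⟩
      d * ∣ C ∣                               ∎
    unit : ∀ m j a → 1ℤ ℤ.* (1ℤ ℤ.+ m ℤ.* j ℤ.* a) ℤ.+ ℤ.- (j ℤ.* a) ℤ.* m ≡ 1ℤ
    unit = ℤ-Solver.solve-∀
    C⊥m : Coprime ∣ C ∣ m
    C⊥m = bézout⇒coprime {C} {+ m} (1ℤ , ℤ.- (j ℤ.* a) , unit (+ m) j a)

  cofactor-coprime : gcd t N ≡ d → N ≡ d * m → .{{NonZero d}} → ∃ λ s → t ≡ s * d × Coprime s m
  cofactor-coprime {t} {N} {d} {m} gcd≡d refl = split (subst (_∣ t) gcd≡d (gcd[m,n]∣m t N))
    where
    split : d ∣ t → ∃ λ s → t ≡ s * d × Coprime s m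
    split (divides s refl) = s , refl , gcd≡1⇒coprime (ℕ.*-cancelˡ-≡ (gcd s m) 1 d (begin
      d * gcd s m            ≡⟨ c*gcd[m,n]≡gcd[cm,cn] d s m ⟩
      gcd (d * s) (d * m)    ≡⟨ cong (λ x → gcd x (d * m)) (ℕ.*-comm d s) ⟩
      gcd (s * d) (d * m)    ≡⟨ gcd≡d ⟩
      d                      ≡⟨ sym (ℕ.*-identityʳ d) ⟩
      d * 1                  ∎))

  width-∣ : N ≡ d * m → d ≡ k * g → m ≡ w * g → t ≡ s * d → N ∣ w * (t * t)
  width-∣ {k = k} {g} {w = w} {s = s} refl refl refl refl = divides (s * s * k) (identity k g w s)
    where
    identity : ∀ k g w s → w * (s * (k * g) * (s * (k * g))) ≡ s * s * k * (k * g * (w * g))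
    identity = solve-∀

  width-least : N ≡ d * m → d ≡ k * g → m ≡ w * g → t ≡ s * d → .{{NonZero d}} → Coprime k w → Coprime s m →
    ∀ h → N ∣ h * (t * t) → w ∣ h
  width-least {k = k} {g} {w = w} {s = s} refl refl refl refl k⊥w s⊥m h N∣ =
    coprime-divisor w⊥s (subst (w ∣_) (ℕ.*-comm h s) w∣hs)
    where
    instance
      _ : NonZero g
      _ = ℕ.m*n≢0⇒n≢0 k
      _ : NonZero (k * g * g)
      _ = ℕ.m*n≢0 (k * g) g
    w⊥s : Coprime w s
    w⊥s = coprime-∣ˡ (m∣m*n g) (Coprime.sym s⊥m)
    lhs : ∀ k g w → k * g * (w * g) ≡ k * g * g * w
    lhs = solve-∀
    rhs : ∀ k g s h → h * (s * (k * g) * (s * (k * g))) ≡ k * g * g * (h * s * s * k)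
    rhs = solve-∀
    w∣hssk : w ∣ h * s * s * k
    w∣hssk = *-cancelˡ-∣ (k * g * g) (subst₂ _∣_ (lhs k g w) (rhs k g s h) N∣)
    w∣hss : w ∣ h * s * s
    w∣hss = coprime-divisor (Coprime.sym k⊥w) (subst (w ∣_) (ℕ.*-comm (h * s * s) k) w∣hssk)
    w∣hs : w ∣ h * s
    w∣hs = coprime-divisor w⊥s (subst (w ∣_) (ℕ.*-comm (h * s) s) w∣hss)

  width²-∣ : N ≡ d * m → t ≡ s * d → N * N ∣ (m * m) * (t * t)
  width²-∣ {d = d} {m} {s = s} refl refl = divides (s * s) (identity d m s)
    where
    identity : ∀ d m s → m * m * (s * d * (s * d)) ≡ s * s * (d * m * (d * m))
    identity = solve-∀

  width²-least : N ≡ d * m → t ≡ s * d → .{{NonZero d}} → Coprime s m → ∀ h → N * N ∣ h * (t * t) → m * m ∣ h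
  width²-least {d = d} {m} {s = s} refl refl s⊥m h NN∣ =
    coprime-divisor mm⊥ss (*-cancelˡ-∣ (d * d) (subst₂ _∣_ (lhs d m) (rhs d m s h) NN∣))
    where
    instance
      _ : NonZero (d * d)
      _ = ℕ.m*n≢0 d d
    lhs : ∀ d m → d * m * (d * m) ≡ d * d * (m * m)
    lhs = solve-∀
    rhs : ∀ d m s h → h * (s * d * (s * d)) ≡ d * d * (s * s * h)
    rhs = solve-∀
    m⊥ss : Coprime m (s * s)
    m⊥ss = Coprime.sym (coprime-*ˡ s⊥m s⊥m)
    mm⊥ss : Coprime (m * m) (s * s)
    mm⊥ss = coprime-*ˡ m⊥ss m⊥ss

  ramification : e * d ≡ N * g → N ≡ d * m → m ≡ w * g → .{{NonZero d}} → e * w ≡ m * m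
  ramification {e} {d} {g = g} {w = w} ed≡Ng refl refl = begin
    e * w               ≡⟨ cong (_* w) e≡wgg ⟩
    w * g * g * w       ≡⟨ swap w g ⟩
    w * g * (w * g)     ∎
    where
    rearrange : ∀ d w g → d * (w * g) * g ≡ w * g * g * d
    rearrange = solve-∀
    swap : ∀ w g → w * g * g * w ≡ w * g * (w * g)
    swap = solve-∀
    e≡wgg : e ≡ w * g * g
    e≡wgg = ℕ.*-cancelʳ-≡ e (w * g * g) d (trans ed≡Ng (rearrange d w g))

open import Data.Nat using (ℕ; _<_; _*_)
open import Data.Nat.Base using (NonZero; z<s; >-nonZero; ≢-nonZero; ≢-nonZero⁻¹)
import Data.Nat.Properties as ℕ
open import Data.Nat.Divisibility using (_∣_)
open import Data.Nat.DivMod using (_/_; m/n*n≡m; m*n/n≡m)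
open import Data.Nat.GCD using (gcd; gcd[m,n]∣n; gcd[m,n]≢0)
open import Data.Nat.Coprimality using (Coprime; coprime-/gcd)
open import Data.Integer using (ℤ; +_; ∣_∣)
open import Data.Fin using (Fin)
open import Data.Fin.Base using (toℕ)
open Coprimality using (Bézout; bézout⇒coprime; coprime⇒bézout)

module Fibre (N d m k g w : ℕ) (a : ℤ) (dm≡N : d * m ≡ N) (d≡kg : d ≡ k * g) (m≡wg : m ≡ w * g)
             (k⊥w : Coprime k w) (a⊥d : Bézout a (+ d)) {{d≢0 : NonZero d}} {{m≢0 : NonZero m}} where
  open import Data.Nat.Base using (>-nonZero⁻¹)
  open import Data.Nat.Divisibility using (m∣m*n)
  import Data.Integer.Base as ℤ
  import Data.Integer.Properties as ℤ
  open import Data.Integer.DivMod using (_/ℕ_; a≡a%ℕn+[a/ℕn]*n; n%ℕd<d)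
  import Data.Integer.Divisibility.Signed as Signed
  open import Data.Fin.Base using (fromℕ<)
  import Data.Fin.Properties as Fin
  open Coprimality
  open ModularGroup
  open CuspWidths
  open CuspNormalForm
  open LowerTranslates
  open FibreArithmetic

  instance
    N≢0 : NonZero N
    N≢0 = subst NonZero dm≡N (ℕ.m*n≢0 d m)
    NN≢0 : NonZero (N * N)
    NN≢0 = ℕ.m*n≢0 N N
    kg≢0 : NonZero (k * g)
    kg≢0 = subst NonZero d≡kg d≢0
    k≢0 : NonZero k
    k≢0 = ℕ.m*n≢0⇒m≢0 k
    g≢0 : NonZero g
    g≢0 = ℕ.m*n≢0⇒n≢0 k

  N≡dm : N ≡ d * m
  N≡dm = sym dm≡N

  +N≡ : + N ≡ + d ℤ.* + m
  +N≡ = trans (cong +_ N≡dm) (ℤ.pos-* d m)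

  +NN≡ : + (N * N) ≡ + N ℤ.* + N
  +NN≡ = ℤ.pos-* N N

  cusp : ℤ → Pt
  cusp j = a , + N ℤ.* j ℤ.* a ℤ.+ + d

  cusp-over : ∀ j → CuspEq N (cusp j) (a , + d)
  cusp-over j = lower (ℤ.- (+ N ℤ.* j)) , InΓ₀-lower N∣ , act-lower-cancel (+ N ℤ.* j) a (+ d)
    where
    N∣ : + N Signed.∣ ℤ.- (+ N ℤ.* j)
    N∣ = Signed.∣m⇒∣-m (Signed.∣m⇒∣m*n j Signed.∣-refl)

  +d≡ : + d ≡ + k ℤ.* + g
  +d≡ = trans (cong +_ d≡kg) (ℤ.pos-* k g)

  +m≡ : + m ≡ + w ℤ.* + g
  +m≡ = trans (cong +_ m≡wg) (ℤ.pos-* w g)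

  cusp-lift : ∀ {x} → CuspEq N x (a , + d) → ∃ λ j → CuspEq (N * N) x (cusp j)
  cusp-lift {x} x~ = to-cusp (cuspEq-lift x~)
    where
    to-cusp : ∃ (λ j → CuspEq (N * N) x (act (lower (+ N ℤ.* j)) (a , + d))) → ∃ λ j → CuspEq (N * N) x (cusp j)
    to-cusp (j , x~) = j , subst (CuspEq (N * N) x) (act-lower (+ N ℤ.* j) a (+ d)) x~

  cusp-shift : ∀ j r → CuspEq (N * N) (cusp (j ℤ.+ + k ℤ.* r)) (cusp j)
  cusp-shift = cuspEq-shift (N * N) {K = + k} {+ g} {+ w} +NN≡ +N≡ +d≡ +m≡ a

  cusp-reduce : ∀ j → ∃ λ (i : Fin k) → CuspEq (N * N) (cusp j) (cusp (+ toℕ i))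
  cusp-reduce j = i , subst (λ j → CuspEq (N * N) (cusp j) (cusp (+ toℕ i))) (sym j≡) (cusp-shift (+ toℕ i) (j /ℕ k))
    where
    i = fromℕ< (n%ℕd<d j k)
    j≡ : j ≡ + toℕ i ℤ.+ + k ℤ.* (j /ℕ k)
    j≡ = trans (a≡a%ℕn+[a/ℕn]*n j k)
               (cong₂ ℤ._+_ (cong +_ (sym (Fin.toℕ-fromℕ< (n%ℕd<d j k)))) (ℤ.*-comm (j /ℕ k) (+ k)))

  cusp-separate : ∀ {i j} → i < k → j < k → CuspEq (N * N) (cusp (+ i)) (cusp (+ j)) → i ≡ j
  cusp-separate {i} {j} i<k j<k i~j = ≡-if-∣-difference i<k j<k (∣-cancel-common d≡kg m≡wg k⊥w _ d∣m[j-i])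
    where
    d∣m[j-i] : d ∣ m * ∣ + j ℤ.- + i ∣
    d∣m[j-i] = subst (d ∣_) (ℤ.abs-* (+ m) (+ j ℤ.- + i)) (cuspEq⇒∣ (N * N) +NN≡ +N≡ a⊥d (+ i) (+ j) i~j)

  cusp-bézout : ∀ j → uncurry Bézout (cusp j)
  cusp-bézout j = subst (Bézout a) (ℤ.+-comm (+ d) (+ N ℤ.* j ℤ.* a)) (bézout-shiftʳ (+ N ℤ.* j) a⊥d)

  denominator : ℤ → ℕ
  denominator j = gcd ∣ proj₂ (cusp j) ∣ (N * N)

  normal-form : ∀ j → ∃ λ x → Bézout x (+ denominator j) × CuspEq (N * N) (cusp j) (x , + denominator j)
  normal-form j = cuspEq-gcd-denominator (N * N) (cusp-bézout j)

  representative : ℤ → ℤ × ℕ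
  representative j = proj₁ (normal-form j) , denominator j

  representative-bézout : ∀ j → uncurry Bézout (pt (representative j))
  representative-bézout j = proj₁ (proj₂ (normal-form j))

  cusp-representative : ∀ j → CuspEq (N * N) (cusp j) (pt (representative j))
  cusp-representative j = proj₂ (proj₂ (normal-form j))

  denominator-∣ : ∀ j → denominator j ∣ N * N
  denominator-∣ j = gcd[m,n]∣n ∣ proj₂ (cusp j) ∣ (N * N)

  gcd-denominator : ∀ j → gcd (denominator j) N ≡ d
  gcd-denominator j = gcd-lower-translate a j N≡dm

  representative-over : ∀ j → CuspEq N (pt (representative j)) (a , + d)
  representative-over j = cuspEq-trans (cuspEq-∣ (m∣m*n N) (cuspEq-sym (cusp-representative j))) (cusp-over j)

  representative-widths : ∀ j →
    IsWidth N (pt (representative j)) w × IsWidth (N * N) (pt (representative j)) (m * m)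
  representative-widths j = widths (cofactor-coprime {t = denominator j} (gcd-denominator j) N≡dm)
    where
    instance
      w≢0 : NonZero w
      w≢0 = ℕ.m*n≢0⇒m≢0 w {{subst NonZero m≡wg m≢0}}
    widths : ∃ (λ s → denominator j ≡ s * d × Coprime s m) →
      IsWidth N (pt (representative j)) w × IsWidth (N * N) (pt (representative j)) (m * m)
    widths (s , t≡sd , s⊥m) =
      isWidth (representative-bézout j) (>-nonZero⁻¹ w) (width-∣ {k = k} {g = g} {w = w} {s = s} N≡dm d≡kg m≡wg t≡sd)
        (width-least {k = k} {g = g} {w = w} {s = s} N≡dm d≡kg m≡wg t≡sd k⊥w s⊥m) ,
      isWidth (representative-bézout j) (>-nonZero⁻¹ (m * m) {{ℕ.m*n≢0 m m}}) (width²-∣ {s = s} N≡dm t≡sd)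
        (width²-least {s = s} N≡dm t≡sd s⊥m)

  cusps : Fin k → ℤ × ℕ
  cusps i = representative (+ toℕ i)

  cusps-distinct : ∀ i j → CuspEq (N * N) (pt (cusps i)) (pt (cusps j)) → i ≡ j
  cusps-distinct i j i~j = Fin.toℕ-injective (cusp-separate (Fin.toℕ<n i) (Fin.toℕ<n j)
    (cuspEq-trans (cusp-representative (+ toℕ i)) (cuspEq-trans i~j (cuspEq-sym (cusp-representative (+ toℕ j))))))

  cusps-cover : ∀ x → CuspEq N x (a , + d) → ∃ λ i → CuspEq (N * N) x (pt (cusps i))
  cusps-cover x x~ = reduce (cusp-lift x~)
    where
    reduce : ∃ (λ j → CuspEq (N * N) x (cusp j)) → ∃ λ i → CuspEq (N * N) x (pt (cusps i))
    reduce (j , x~j) = represent (cusp-reduce j)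
      where
      represent : ∃ (λ i → CuspEq (N * N) (cusp j) (cusp (+ toℕ i))) → ∃ λ i → CuspEq (N * N) x (pt (cusps i))
      represent (i , j~i) = i , cuspEq-trans x~j (cuspEq-trans j~i (cusp-representative (+ toℕ i)))

lemma3p2 : (N : ℕ) → 1 < N → (a : ℤ) (d : ℕ) → d ∣ N → Coprime ∣ a ∣ d →
  (m k e : ℕ) → d * m ≡ N → d ≡ k * gcd d m → e * d ≡ N * gcd d m →
  Σ (Fin k → ℤ × ℕ) λ cs →
    (∀ i → (proj₂ (cs i) ∣ N * N) × (gcd (proj₂ (cs i)) N ≡ d)
       × Coprime ∣ proj₁ (cs i) ∣ (proj₂ (cs i))
       × CuspEq N (pt (cs i)) (a , + d)
       × ∃ λ w → IsWidth N (pt (cs i)) w × IsWidth (N * N) (pt (cs i)) (e * w))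
    × (∀ i j → CuspEq (N * N) (pt (cs i)) (pt (cs j)) → i ≡ j)
    × (∀ x → IsCusp x → CuspEq N x (a , + d) → ∃ λ i → CuspEq (N * N) x (pt (cs i)))
lemma3p2 N 1<N a d _ a⊥d m k e dm≡N d≡kg ed≡Ng =
  cusps ,
  (λ i → let j = + toℕ i in
    denominator-∣ j , gcd-denominator j , bézout⇒coprime (representative-bézout j) ,
    representative-over j , w , proj₁ (representative-widths j) ,
    subst (IsWidth (N * N) (pt (representative j))) (sym ew≡mm) (proj₂ (representative-widths j))) ,
  cusps-distinct ,
  λ x _ → cusps-cover x
  where
  g = gcd d m
  instance
    dm≢0 : NonZero (d * m)
    dm≢0 = subst NonZero (sym dm≡N) (>-nonZero (ℕ.<-trans z<s 1<N))
    d≢0 : NonZero d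
    d≢0 = ℕ.m*n≢0⇒m≢0 d
    m≢0 : NonZero m
    m≢0 = ℕ.m*n≢0⇒n≢0 d
    g≢0 : NonZero g
    g≢0 = ≢-nonZero (gcd[m,n]≢0 d m (inj₁ (≢-nonZero⁻¹ d)))
  w = m / g
  m≡wg : m ≡ w * g
  m≡wg = sym (m/n*n≡m (gcd[m,n]∣n d m))
  k⊥w : Coprime k w
  k⊥w = subst (λ x → Coprime x w) (trans (cong (_/ g) d≡kg) (m*n/n≡m k g)) (coprime-/gcd d m)
  ew≡mm : e * w ≡ m * m
  ew≡mm = FibreArithmetic.ramification {e = e} {d = d} {g = g} {w = w} ed≡Ng (sym dm≡N) m≡wg
  open Fibre N d m k g w a dm≡N d≡kg m≡wg k⊥w (coprime⇒bézout a⊥d) {{d≢0}} {{m≢0}}
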